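{- Let $K$ be an even integer and let $m>1$ be an integer with $4\nmid m$. Then: (1) if $m>3$, then $\omega_K(m)=4$ if and only if $\alpha_K(m)\equiv\pm1\pmod 4$; (2) $\omega_K(m)=2$ if and only if $4\mid\pi_K(m)$ and $2\mid\alpha_K(m)$; (3) $\omega_K(m)=1$ if and only if $4\nmid\pi_K(m)$.
   Context: For an integer $K$, the $K$-Fibonacci sequence is $F_{K,0}=0$, $F_{K,1}=1$, $F_{K,n}=KF_{K,n-1}+F_{K,n-2}$ for $n\ge2$. For an integer $m\ge 2$, $\pi_K(m)$ is the least positive period of $(F_{K,n}\bmod m)$, $\alpha_K(m)$ is the least positive index $n$ with $m\mid F_{K,n}$, and $\omega_K(m)$ is the number of indices $0\le n<\pi_K(m)$ with $m\mid F_{K,n}$. -}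

module Defs where

open import Data.Nat as ℕ using (ℕ; zero; suc; _<_)
open import Data.Integer as ℤ using (ℤ; +_; _-_)
open import Data.Integer.Divisibility using (_∣_)
import Data.Nat.Divisibility as ℕD
open import Data.List using (List; length; filter; upTo)
open import Relation.Nullary using (¬_)

F : ℤ → ℕ → ℤ
F K zero = + 0
F K (suc zero) = + 1
F K (suc (suc n)) = K ℤ.* F K (suc n) ℤ.+ F K n

IsPeriod : ℤ → ℕ → ℕ → Set
IsPeriod K m p = 0 < p × (∀ n → (+ m) ∣ (F K (n ℕ.+ p) - F K n))
  where open import Data.Product using (_×_)

IsPisano : ℤ → ℕ → ℕ → Set
IsPisano K m p = IsPeriod K m p × (∀ q → 0 < q → q < p → ¬ IsPeriod K m q)
  where open import Data.Product using (_×_)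

IsRankOfApparition : ℤ → ℕ → ℕ → Set
IsRankOfApparition K m a =
  0 < a × (+ m) ∣ F K a × (∀ n → 0 < n → n < a → ¬ ((+ m) ∣ F K n))
  where open import Data.Product using (_×_)

-- ω: number of indices 0 ≤ n < p with m ∣ F K n  (p intended to be π_K(m))
-- (integer divisibility i ∣ j is by definition ∣i∣ ∣ ∣j∣ on ℕ)
omegaUpTo : ℤ → ℕ → ℕ → ℕ
omegaUpTo K m p = length (filter (λ n → m ℕD.∣? ℤ.∣ F K n ∣) (upTo p))

{-# OPTIONS --safe #-}
module Submission where

-- Let α = α_K(m) and c = F(α+1). Since m ∣ F(α), induction gives F(n + kα) ≡ cᵏ F(n) (mod m),
-- and Cassini's identity gives c² ≡ (-1)^α, so c is a unit mod m. Hence m ∣ F(n) exactly when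
-- α ∣ n, the Pisano period is π = jα with j the multiplicative order of c, and ω = j.
-- For even K, F(n) is even exactly when n is. If α is odd, then m ≠ 2 and c² ≡ -1 ≢ 1, so j = 4.
-- If α is even, then c² ≡ 1 and j ∈ {1, 2}; when c ≡ 1 the sequence is antisymmetric about α/2,
-- F(α - i) ≡ (-1)^(i+1) F(i), so α = 4b would give m ∣ 2F(2b) with F(2b) even, hence m ∣ F(2b)
-- because 4 ∤ m, contradicting the minimality of α. So j = 1 forces 4 ∤ α = π.

open import Defs
open import Data.Nat
  using (ℕ; zero; suc; _+_; _*_; _≤_; _<_; _%_; z<s; s<s; NonZero; >-nonZero)
open import Data.Nat.Properties
open import Data.Nat.Divisibility
  using ( _∣_; divides; _∣?_; ∣⇒≤; 0∣⇒≡0; ∣1⇒≡1; 1∣_; _∣0; ∣-refl; n∣m*n; m∣m*n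
        ; ∣m∣n⇒∣m+n; ∣m+n∣m⇒∣n; *-monoˡ-∣; *-monoʳ-∣; *-cancelʳ-∣; m%n≡0⇒n∣m; n∣m⇒m%n≡0 )
open import Data.Nat.DivMod using (_/_; m%n<n; m∣n⇒o%n%m≡o%m; m≡m%n+[m/n]*n)
open import Data.Nat.Coprimality using (Coprime; coprime-divisor)
open import Data.Nat.Primality using (irreducible[2])
open import Data.Integer using (ℤ; +_; 0ℤ; 1ℤ; -1ℤ; -_; _-_; _^_)
import Data.Integer as ℤ
import Data.Integer.Properties as ℤ
open import Data.Integer.Divisibility using () renaming (_∣_ to _∣ℤ_)
import Data.Integer.Divisibility.Signed as Signed
open import Data.Integer.Tactic.RingSolver using (solve-∀)
open import Data.List using (length; filter; upTo; [_]; _++_)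
open import Data.List.Properties using (upTo-∷ʳ; filter-++; length-++; filter-accept; filter-reject)
open import Data.Product using (_×_; _,_; proj₁; proj₂; ∃-syntax)
open import Data.Sum using (_⊎_; inj₁; inj₂)
import Data.Sum as Sum
open import Function.Base using (_∘_)
open import Function.Bundles using (_⇔_; mk⇔; Equivalence)
open import Relation.Nullary using (¬_; yes; no; contradiction)
open import Relation.Unary using (Pred; Decidable)
open import Relation.Binary using (IsEquivalence; Setoid)
import Relation.Binary.Reasoning.Setoid
open import Relation.Binary.PropositionalEquality
  using (_≡_; _≢_; refl; sym; trans; cong; subst; module ≡-Reasoning)

odd⇒coprime-2 : ∀ {m} → ¬ 2 ∣ m → Coprime m 2
odd⇒coprime-2 2∤m (d∣m , d∣2) with irreducible[2] d∣2
... | inj₁ d≡1 = d≡1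
... | inj₂ refl = contradiction d∣m 2∤m

∣2*x⇒∣x : ∀ {m x} → ¬ 4 ∣ m → m ∣ 2 * x → 2 ∣ x → m ∣ x
∣2*x⇒∣x {m} 4∤m m∣2x 2∣x with 2 ∣? m
... | no 2∤m = coprime-divisor (odd⇒coprime-2 2∤m) m∣2x
∣2*x⇒∣x {_} {x} 4∤m m∣2x (divides y refl) | yes (divides t refl) =
  *-monoˡ-∣ 2 (coprime-divisor {o = y} (odd⇒coprime-2 2∤t) t∣2y)
  where
  2∤t : ¬ 2 ∣ t
  2∤t 2∣t = 4∤m (*-monoˡ-∣ 2 2∣t)
  t∣2y : t ∣ 2 * y
  t∣2y = *-cancelʳ-∣ 2 (subst (t * 2 ∣_) (sym (*-assoc 2 y 2)) m∣2x)

∣4∧∤2⇒≡4 : ∀ {j} → j ∣ 4 → ¬ j ∣ 2 → j ≡ 4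
∣4∧∤2⇒≡4 {0} j∣4 _ with () ← 0∣⇒≡0 j∣4
∣4∧∤2⇒≡4 {1} _ j∤2 = contradiction (1∣ 2) j∤2
∣4∧∤2⇒≡4 {2} _ j∤2 = contradiction ∣-refl j∤2
∣4∧∤2⇒≡4 {3} (divides (suc (suc _)) ()) _
∣4∧∤2⇒≡4 {4} _ _ = refl
∣4∧∤2⇒≡4 {suc (suc (suc (suc (suc _))))} j∣4 _ with s<s (s<s (s<s (s<s ()))) ← ∣⇒≤ j∣4

¬2∣n⇔n%4≡1∨3 : ∀ n → (¬ 2 ∣ n) ⇔ (n % 4 ≡ 1 ⊎ n % 4 ≡ 3)
¬2∣n⇔n%4≡1∨3 n = mk⇔ (residue (n % 4) refl (m%n<n n 4)) odd-residue
  where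
  n%4%2≡n%2 : n % 4 % 2 ≡ n % 2
  n%4%2≡n%2 = m∣n⇒o%n%m≡o%m 2 4 n (divides 2 refl)
  n%4%2≡0⇒2∣n : n % 4 % 2 ≡ 0 → 2 ∣ n
  n%4%2≡0⇒2∣n n%4%2≡0 = m%n≡0⇒n∣m n 2 (trans (sym n%4%2≡n%2) n%4%2≡0)
  2∣n⇒n%4%2≡0 : 2 ∣ n → n % 4 % 2 ≡ 0
  2∣n⇒n%4%2≡0 2∣n = trans n%4%2≡n%2 (n∣m⇒m%n≡0 n 2 2∣n)
  residue : ∀ r → n % 4 ≡ r → r < 4 → ¬ 2 ∣ n → r ≡ 1 ⊎ r ≡ 3
  residue 0 n%4≡0 _ 2∤n = contradiction (n%4%2≡0⇒2∣n (cong (_% 2) n%4≡0)) 2∤n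
  residue 1 _ _ _ = inj₁ refl
  residue 2 n%4≡2 _ 2∤n = contradiction (n%4%2≡0⇒2∣n (cong (_% 2) n%4≡2)) 2∤n
  residue 3 _ _ _ = inj₂ refl
  residue (suc (suc (suc (suc _)))) _ (s<s (s<s (s<s (s<s ())))) _
  odd-residue : n % 4 ≡ 1 ⊎ n % 4 ≡ 3 → ¬ 2 ∣ n
  odd-residue (inj₁ n%4≡1) 2∣n with () ← trans (sym (2∣n⇒n%4%2≡0 2∣n)) (cong (_% 2) n%4≡1)
  odd-residue (inj₂ n%4≡3) 2∣n with () ← trans (sym (2∣n⇒n%4%2≡0 2∣n)) (cong (_% 2) n%4≡3)

module _ {ℓ} {P : Pred ℕ ℓ} (P? : Decidable P) where

  count : ℕ → ℕ
  count n = length (filter P? (upTo n))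

  count-suc : ∀ n → count (suc n) ≡ count n + length (filter P? [ n ])
  count-suc n = begin
    length (filter P? (upTo (suc n)))               ≡⟨ cong (length ∘ filter P?) (upTo-∷ʳ n) ⟨
    length (filter P? (upTo n ++ [ n ]))            ≡⟨ cong length (filter-++ P? (upTo n) [ n ]) ⟩
    length (filter P? (upTo n) ++ filter P? [ n ])  ≡⟨ length-++ (filter P? (upTo n)) ⟩
    count n + length (filter P? [ n ])              ∎
    where open ≡-Reasoning

  count-suc-accept : ∀ {n} → P n → count (suc n) ≡ suc (count n)
  count-suc-accept {n} Pn =
    trans (count-suc n) (trans (cong (_+_ (count n) ∘ length) (filter-accept P? Pn)) (+-comm (count n) 1))

  count-suc-reject : ∀ {n} → ¬ P n → count (suc n) ≡ count n
  count-suc-reject {n} ¬Pn =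
    trans (count-suc n) (trans (cong (_+_ (count n) ∘ length) (filter-reject P? ¬Pn)) (+-identityʳ (count n)))

  count-multiples : ∀ {a} → 0 < a → (∀ {n} → P n ⇔ a ∣ n) → ∀ j → count (j * a) ≡ j
  count-multiples {a@(suc a′)} _ P⇔a∣ = count-up-to
    where
    count-up-to : ∀ j → count (j * a) ≡ j
    count-up-to zero = refl
    count-up-to (suc j) = count-block a′ ≤-refl
      where
      count-block : ∀ i → i < a → count (suc (i + j * a)) ≡ suc j
      count-block zero _ =
        trans (count-suc-accept (Equivalence.from P⇔a∣ (n∣m*n j))) (cong suc (count-up-to j))
      count-block (suc i) 1+i<a = trans (count-suc-reject ¬P) (count-block i (<-trans (n<1+n i) 1+i<a))
        where
        ¬P : ¬ P (suc i + j * a)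
        ¬P P[1+i+ja] = <⇒≱ 1+i<a (∣⇒≤ (∣m+n∣m⇒∣n a∣ja+1+i (n∣m*n j)))
          where
          a∣ja+1+i : a ∣ j * a + suc i
          a∣ja+1+i = subst (a ∣_) (+-comm (suc i) (j * a)) (Equivalence.to P⇔a∣ P[1+i+ja])

module Modulo (m : ℕ) where

  infix 4 _≈_
  -- A record rather than a synonym for + m ∣ x - y, so that x and y can be inferred from a proof.
  record _≈_ (x y : ℤ) : Set where
    constructor mk≈
    field m∣x-y : + m Signed.∣ x - y

  private
    variable
      x y z u v : ℤ
      j k : ℕ

    ∣-resp-≡ : x ≡ y → + m Signed.∣ x → + m Signed.∣ y
    ∣-resp-≡ = subst (+ m Signed.∣_)

  ≈-reflexive : x ≡ y → x ≈ y
  ≈-reflexive {x} refl = mk≈ (∣-resp-≡ (sym (ℤ.+-inverseʳ x)) (Signed.divides 0ℤ refl))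

  ≈-sym : x ≈ y → y ≈ x
  ≈-sym {x} {y} (mk≈ m∣x-y) = mk≈ (∣-resp-≡ (identity x y) (Signed.∣m⇒∣-m m∣x-y))
    where
    identity : ∀ x y → - (x - y) ≡ y - x
    identity = solve-∀

  ≈-trans : x ≈ y → y ≈ z → x ≈ z
  ≈-trans {x} {y} {z} (mk≈ m∣x-y) (mk≈ m∣y-z) =
    mk≈ (∣-resp-≡ (identity x y z) (Signed.∣m∣n⇒∣m+n m∣x-y m∣y-z))
    where
    identity : ∀ x y z → (x - y) ℤ.+ (y - z) ≡ x - z
    identity = solve-∀

  ≈-refl : x ≈ x
  ≈-refl = ≈-reflexive refl

  ≈-isEquivalence : IsEquivalence _≈_
  ≈-isEquivalence = record { refl = ≈-refl ; sym = ≈-sym ; trans = ≈-trans }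

  ≈-setoid : Setoid _ _
  ≈-setoid = record { isEquivalence = ≈-isEquivalence }

  module ≈-Reasoning = Relation.Binary.Reasoning.Setoid ≈-setoid

  +-cong : x ≈ y → u ≈ v → x ℤ.+ u ≈ y ℤ.+ v
  +-cong {x} {y} {u} {v} (mk≈ m∣x-y) (mk≈ m∣u-v) =
    mk≈ (∣-resp-≡ (identity x y u v) (Signed.∣m∣n⇒∣m+n m∣x-y m∣u-v))
    where
    identity : ∀ x y u v → (x - y) ℤ.+ (u - v) ≡ (x ℤ.+ u) - (y ℤ.+ v)
    identity = solve-∀

  *-cong : x ≈ y → u ≈ v → x ℤ.* u ≈ y ℤ.* v
  *-cong {x} {y} {u} {v} (mk≈ m∣x-y) (mk≈ m∣u-v) =
    mk≈ (∣-resp-≡ (identity x y u v)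
                  (Signed.∣m∣n⇒∣m+n (Signed.∣m⇒∣m*n u m∣x-y) (Signed.∣n⇒∣m*n y m∣u-v)))
    where
    identity : ∀ x y u v → (x - y) ℤ.* u ℤ.+ y ℤ.* (u - v) ≡ x ℤ.* u - y ℤ.* v
    identity = solve-∀

  -‿cong : x ≈ y → - x ≈ - y
  -‿cong {x} {y} (mk≈ m∣x-y) = mk≈ (∣-resp-≡ (identity x y) (Signed.∣m⇒∣-m m∣x-y))
    where
    identity : ∀ x y → - (x - y) ≡ - x - - y
    identity = solve-∀

  ^-cong : x ≈ y → ∀ n → x ^ n ≈ y ^ n
  ^-cong x≈y zero = ≈-refl
  ^-cong x≈y (suc n) = *-cong x≈y (^-cong x≈y n)

  ≈0⇒∣ : x ≈ 0ℤ → m ∣ ℤ.∣ x ∣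
  ≈0⇒∣ {x} (mk≈ m∣x-0) = Signed.∣⇒∣ᵤ (∣-resp-≡ (ℤ.+-identityʳ x) m∣x-0)

  ∣⇒≈0 : m ∣ ℤ.∣ x ∣ → x ≈ 0ℤ
  ∣⇒≈0 {x} m∣x = mk≈ (∣-resp-≡ (sym (ℤ.+-identityʳ x)) (Signed.∣ᵤ⇒∣ m∣x))

  *-cancelˡ-≈0 : u ℤ.* v ≈ 1ℤ → u ℤ.* x ≈ 0ℤ → x ≈ 0ℤ
  *-cancelˡ-≈0 {u} {v} {x} uv≈1 ux≈0 = begin
    x                  ≡⟨ ℤ.*-identityˡ x ⟨
    1ℤ ℤ.* x           ≈⟨ *-cong (≈-sym uv≈1) (≈-refl {x}) ⟩
    (u ℤ.* v) ℤ.* x    ≡⟨ identity u v x ⟩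
    v ℤ.* (u ℤ.* x)    ≈⟨ *-cong (≈-refl {v}) ux≈0 ⟩
    v ℤ.* 0ℤ           ≡⟨ ℤ.*-zeroʳ v ⟩
    0ℤ                 ∎
    where
    open ≈-Reasoning
    identity : ∀ u v x → (u ℤ.* v) ℤ.* x ≡ v ℤ.* (u ℤ.* x)
    identity = solve-∀

  ^-cancelˡ-≈0 : u ℤ.* v ≈ 1ℤ → ∀ k → u ^ k ℤ.* x ≈ 0ℤ → x ≈ 0ℤ
  ^-cancelˡ-≈0 {x = x} uv≈1 zero uᵏx≈0 = ≈-trans (≈-reflexive (sym (ℤ.*-identityˡ x))) uᵏx≈0
  ^-cancelˡ-≈0 {u} {v} {x} uv≈1 (suc k) u¹⁺ᵏx≈0 =
    ^-cancelˡ-≈0 {u} {v} uv≈1 k (*-cancelˡ-≈0 {u} {v} uv≈1 u[uᵏx]≈0)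
    where
    u[uᵏx]≈0 : u ℤ.* (u ^ k ℤ.* x) ≈ 0ℤ
    u[uᵏx]≈0 = ≈-trans (≈-reflexive (sym (ℤ.*-assoc u (u ^ k) x))) u¹⁺ᵏx≈0

  IsOrder : ℤ → ℕ → Set
  IsOrder u j = 0 < j × u ^ j ≈ 1ℤ × (∀ {k} → 0 < k → u ^ k ≈ 1ℤ → j ≤ k)

  ^[q*j]≈1 : u ^ j ≈ 1ℤ → ∀ q → u ^ (q * j) ≈ 1ℤ
  ^[q*j]≈1 {u} {j} uʲ≈1 q = begin
    u ^ (q * j)   ≡⟨ cong (u ^_) (*-comm q j) ⟩
    u ^ (j * q)   ≡⟨ ℤ.^-*-assoc u j q ⟨
    (u ^ j) ^ q   ≈⟨ ^-cong uʲ≈1 q ⟩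
    1ℤ ^ q        ≡⟨ ℤ.^-zeroˡ q ⟩
    1ℤ            ∎
    where open ≈-Reasoning

  order-∣⇔ : IsOrder u j → u ^ k ≈ 1ℤ ⇔ j ∣ k
  order-∣⇔ {u} {j} {k} (0<j , uʲ≈1 , least) = mk⇔ to from
    where
    instance _ = >-nonZero 0<j
    from : j ∣ k → u ^ k ≈ 1ℤ
    from (divides q refl) = ^[q*j]≈1 uʲ≈1 q
    to : u ^ k ≈ 1ℤ → j ∣ k
    to uᵏ≈1 = m%n≡0⇒n∣m k j (n≤0⇒n≡0 (≮⇒≥ λ 0<r → <⇒≱ (m%n<n k j) (least 0<r uʳ≈1)))
      where
      open ≈-Reasoning
      uʳ≈1 : u ^ (k % j) ≈ 1ℤ
      uʳ≈1 = begin
        u ^ (k % j)                        ≡⟨ ℤ.*-identityʳ _ ⟨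
        u ^ (k % j) ℤ.* 1ℤ                 ≈⟨ *-cong (≈-refl {u ^ (k % j)}) (^[q*j]≈1 uʲ≈1 (k / j)) ⟨
        u ^ (k % j) ℤ.* u ^ (k / j * j)    ≡⟨ ℤ.^-distribˡ-+-* u (k % j) (k / j * j) ⟨
        u ^ (k % j + k / j * j)            ≡⟨ cong (u ^_) (m≡m%n+[m/n]*n k j) ⟨
        u ^ k                              ≈⟨ uᵏ≈1 ⟩
        1ℤ                                 ∎

-1^n*-1^n≡1 : ∀ n → -1ℤ ^ n ℤ.* -1ℤ ^ n ≡ 1ℤ
-1^n*-1^n≡1 zero = refl
-1^n*-1^n≡1 (suc n) = trans (identity (-1ℤ ^ n)) (-1^n*-1^n≡1 n)
  where
  identity : ∀ s → (-1ℤ ℤ.* s) ℤ.* (-1ℤ ℤ.* s) ≡ s ℤ.* s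
  identity = solve-∀

-1^[2+n]≡-1^n : ∀ n → -1ℤ ^ (2 + n) ≡ -1ℤ ^ n
-1^[2+n]≡-1^n n = identity (-1ℤ ^ n)
  where
  identity : ∀ s → -1ℤ ℤ.* (-1ℤ ℤ.* s) ≡ s
  identity = solve-∀

-1^even : ∀ {n} → 2 ∣ n → -1ℤ ^ n ≡ 1ℤ
-1^even {0} _ = refl
-1^even {1} 2∣1 with () ← ∣1⇒≡1 2∣1
-1^even {suc (suc n)} 2∣2+n = trans (-1^[2+n]≡-1^n n) (-1^even (∣m+n∣m⇒∣n 2∣2+n ∣-refl))

-1^odd : ∀ {n} → ¬ 2 ∣ n → -1ℤ ^ n ≡ -1ℤ
-1^odd {0} 2∤0 = contradiction (2 ∣0) 2∤0
-1^odd {1} _ = refl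
-1^odd {suc (suc n)} 2∤2+n = trans (-1^[2+n]≡-1^n n) (-1^odd (2∤2+n ∘ ∣m∣n⇒∣m+n ∣-refl))

F-cassini : ∀ K n → F K (2 + n) ℤ.* F K n - F K (1 + n) ℤ.* F K (1 + n) ≡ -1ℤ ^ (1 + n)
F-cassini K zero = identity K
  where
  identity : ∀ K → (K ℤ.* 1ℤ ℤ.+ 0ℤ) ℤ.* 0ℤ - 1ℤ ℤ.* 1ℤ ≡ -1ℤ ℤ.* 1ℤ
  identity = solve-∀
F-cassini K (suc n) = begin
  F K (3 + n) ℤ.* F K (1 + n) - F K (2 + n) ℤ.* F K (2 + n)        ≡⟨ identity K (F K n) (F K (suc n)) ⟩
  -1ℤ ℤ.* (F K (2 + n) ℤ.* F K n - F K (1 + n) ℤ.* F K (1 + n))  ≡⟨ cong (-1ℤ ℤ.*_) (F-cassini K n) ⟩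
  -1ℤ ^ (2 + n)                                                  ∎
  where
  open ≡-Reasoning
  identity : ∀ K x y → (K ℤ.* (K ℤ.* y ℤ.+ x) ℤ.+ y) ℤ.* y - (K ℤ.* y ℤ.+ x) ℤ.* (K ℤ.* y ℤ.+ x)
                       ≡ -1ℤ ℤ.* ((K ℤ.* y ℤ.+ x) ℤ.* x - y ℤ.* y)
  identity = solve-∀

module FibonacciModulo (K : ℤ) (m : ℕ) where

  open Modulo m

  F-skip-zero : ∀ {n} → F K (suc n) ≈ 0ℤ → F K (2 + n) ≈ F K n
  F-skip-zero {n} F1+n≈0 = begin
    K ℤ.* F K (suc n) ℤ.+ F K n  ≈⟨ +-cong (*-cong (≈-refl {K}) F1+n≈0) (≈-refl {F K n}) ⟩
    K ℤ.* 0ℤ ℤ.+ F K n           ≡⟨ identity K (F K n) ⟩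
    F K n                        ∎
    where
    open ≈-Reasoning
    identity : ∀ K x → K ℤ.* 0ℤ ℤ.+ x ≡ x
    identity = solve-∀

  F-succ-square : ∀ {a} → 0 < a → F K a ≈ 0ℤ → F K (suc a) ℤ.* F K (suc a) ≈ -1ℤ ^ a
  F-succ-square {suc n} _ F₁≈0 = begin
    F₂ ℤ.* F₂                              ≈⟨ *-cong (≈-refl {F₂}) (F-skip-zero {n} F₁≈0) ⟩
    F₂ ℤ.* F₀                              ≡⟨ identity (F₂ ℤ.* F₀) F₁ ⟩
    (F₂ ℤ.* F₀ - F₁ ℤ.* F₁) ℤ.+ F₁ ℤ.* F₁
                                           ≈⟨ +-cong (≈-reflexive (F-cassini K n)) (*-cong F₁≈0 (≈-refl {F₁})) ⟩
    -1ℤ ^ (1 + n) ℤ.+ 0ℤ ℤ.* F₁            ≡⟨ identity′ (-1ℤ ^ (1 + n)) F₁ ⟩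
    -1ℤ ^ (1 + n)                          ∎
    where
    open ≈-Reasoning
    F₀ = F K n
    F₁ = F K (1 + n)
    F₂ = F K (2 + n)
    identity : ∀ x y → x ≡ (x - y ℤ.* y) ℤ.+ y ℤ.* y
    identity = solve-∀
    identity′ : ∀ s y → s ℤ.+ 0ℤ ℤ.* y ≡ s
    identity′ = solve-∀

  module _ {a : ℕ} (Fa≈0 : F K a ≈ 0ℤ) where

    F-shift : ∀ n → F K (n + a) ≈ F K (suc a) ℤ.* F K n
    F-shift zero = ≈-trans Fa≈0 (≈-reflexive (sym (ℤ.*-zeroʳ (F K (suc a)))))
    F-shift (suc zero) = ≈-reflexive (sym (ℤ.*-identityʳ (F K (suc a))))
    F-shift (suc (suc n)) = begin
      K ℤ.* F K (suc n + a) ℤ.+ F K (n + a)      ≈⟨ +-cong (*-cong (≈-refl {K}) (F-shift (suc n))) (F-shift n) ⟩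
      K ℤ.* (c ℤ.* F K (suc n)) ℤ.+ c ℤ.* F K n  ≡⟨ identity K c (F K n) (F K (suc n)) ⟩
      c ℤ.* (K ℤ.* F K (suc n) ℤ.+ F K n)        ∎
      where
      open ≈-Reasoning
      c = F K (suc a)
      identity : ∀ K c x y → K ℤ.* (c ℤ.* y) ℤ.+ c ℤ.* x ≡ c ℤ.* (K ℤ.* y ℤ.+ x)
      identity = solve-∀

    F-shift-* : ∀ k n → F K (n + k * a) ≈ F K (suc a) ^ k ℤ.* F K n
    F-shift-* zero n = ≈-reflexive (trans (cong (F K) (+-identityʳ n)) (sym (ℤ.*-identityˡ (F K n))))
    F-shift-* (suc k) n = begin
      F K (n + (a + k * a))    ≡⟨ cong (F K) n+[a+ka]≡n+ka+a ⟩
      F K ((n + k * a) + a)    ≈⟨ F-shift (n + k * a) ⟩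
      c ℤ.* F K (n + k * a)    ≈⟨ *-cong (≈-refl {c}) (F-shift-* k n) ⟩
      c ℤ.* (c ^ k ℤ.* F K n)  ≡⟨ ℤ.*-assoc c (c ^ k) (F K n) ⟨
      c ^ suc k ℤ.* F K n      ∎
      where
      open ≈-Reasoning
      c = F K (suc a)
      n+[a+ka]≡n+ka+a : n + (a + k * a) ≡ n + k * a + a
      n+[a+ka]≡n+ka+a = trans (cong (_+_ n) (+-comm a (k * a))) (sym (+-assoc n (k * a) a))

    F-reflect : F K (suc a) ≈ 1ℤ → ∀ i j → i + j ≡ a → F K i ≈ -1ℤ ^ suc j ℤ.* F K j
    F-reflect _ i zero i+0≡a =
      ≈-trans (≈-reflexive (cong (F K) (trans (sym (+-identityʳ i)) i+0≡a))) Fa≈0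
    F-reflect F1+a≈1 i (suc zero) refl = begin
      F K i                  ≈⟨ F-skip-zero {i} (≈-trans (≈-reflexive (cong (F K) (+-comm 1 i))) Fa≈0) ⟨
      F K (2 + i)            ≡⟨ cong (F K ∘ suc) (+-comm 1 i) ⟩
      F K (suc (i + 1))      ≈⟨ F1+a≈1 ⟩
      1ℤ                     ∎
      where open ≈-Reasoning
    F-reflect F1+a≈1 i (suc (suc j)) i+2+j≡a = begin
      F K i
        ≡⟨ identity K (F K i) (F K (suc i)) ⟩
      F K (2 + i) - K ℤ.* F K (1 + i)
        ≈⟨ +-cong (F-reflect F1+a≈1 (suc (suc i)) j 2+i+j≡a)
                  (-‿cong (*-cong (≈-refl {K}) (F-reflect F1+a≈1 (suc i) (suc j) 1+i+1+j≡a))) ⟩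
      s ℤ.* F K j - K ℤ.* (-1ℤ ℤ.* s ℤ.* F K (1 + j))
        ≡⟨ identity′ K s (F K j) (F K (1 + j)) ⟩
      -1ℤ ^ (3 + j) ℤ.* F K (2 + j)
        ∎
      where
      open ≈-Reasoning
      s = -1ℤ ^ suc j
      1+i+1+j≡a : suc i + suc j ≡ a
      1+i+1+j≡a = trans (sym (+-suc i (suc j))) i+2+j≡a
      2+i+j≡a : suc (suc i) + j ≡ a
      2+i+j≡a = trans (cong suc (sym (+-suc i j))) 1+i+1+j≡a
      identity : ∀ K x y → x ≡ (K ℤ.* y ℤ.+ x) - K ℤ.* y
      identity = solve-∀
      identity′ : ∀ K s x y → s ℤ.* x - K ℤ.* (-1ℤ ℤ.* s ℤ.* y) ≡ -1ℤ ℤ.* (-1ℤ ℤ.* s) ℤ.* (K ℤ.* y ℤ.+ x)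
      identity′ = solve-∀

module Rank (K : ℤ) (m a : ℕ) (rank : IsRankOfApparition K m a) where

  open Modulo m
  open FibonacciModulo K m

  0<a : 0 < a
  0<a = proj₁ rank

  Fa≈0 : F K a ≈ 0ℤ
  Fa≈0 = ∣⇒≈0 (proj₁ (proj₂ rank))

  F≉0-below-rank : ∀ {n} → 0 < n → n < a → ¬ F K n ≈ 0ℤ
  F≉0-below-rank 0<n n<a Fn≈0 = proj₂ (proj₂ rank) _ 0<n n<a (≈0⇒∣ Fn≈0)

  private instance
    a≢0 : NonZero a
    a≢0 = >-nonZero 0<a

  c : ℤ
  c = F K (suc a)

  c²≈±1 : c ^ 2 ≈ -1ℤ ^ a
  c²≈±1 = ≈-trans (≈-reflexive (cong (c ℤ.*_) (ℤ.*-identityʳ c))) (F-succ-square 0<a Fa≈0)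

  c^k-cancel : ∀ k x → c ^ k ℤ.* x ≈ 0ℤ → x ≈ 0ℤ
  c^k-cancel k x = ^-cancelˡ-≈0 {c} {c ℤ.* s} {x} c*[c*s]≈1 k
    where
    open ≈-Reasoning
    s = -1ℤ ^ a
    c*[c*s]≈1 : c ℤ.* (c ℤ.* s) ≈ 1ℤ
    c*[c*s]≈1 = begin
      c ℤ.* (c ℤ.* s)   ≡⟨ identity c s ⟩
      c ^ 2 ℤ.* s       ≈⟨ *-cong c²≈±1 (≈-refl {s}) ⟩
      s ℤ.* s           ≡⟨ -1^n*-1^n≡1 a ⟩
      1ℤ                ∎
      where
      identity : ∀ c s → c ℤ.* (c ℤ.* s) ≡ c ℤ.* (c ℤ.* 1ℤ) ℤ.* s
      identity = solve-∀

  F≈0⇔rank∣ : ∀ {n} → F K n ≈ 0ℤ ⇔ a ∣ n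
  F≈0⇔rank∣ {n} = mk⇔ to from
    where
    to : F K n ≈ 0ℤ → a ∣ n
    to Fn≈0 = m%n≡0⇒n∣m n a (n≤0⇒n≡0 (≮⇒≥ λ 0<r → F≉0-below-rank 0<r (m%n<n n a) Fr≈0))
      where
      Fr≈0 : F K (n % a) ≈ 0ℤ
      Fr≈0 = c^k-cancel (n / a) (F K (n % a)) (begin
        c ^ (n / a) ℤ.* F K (n % a)  ≈⟨ F-shift-* Fa≈0 (n / a) (n % a) ⟨
        F K (n % a + n / a * a)      ≡⟨ cong (F K) (m≡m%n+[m/n]*n n a) ⟨
        F K n                        ≈⟨ Fn≈0 ⟩
        0ℤ                           ∎)
        where open ≈-Reasoning
    from : a ∣ n → F K n ≈ 0ℤ
    from (divides q refl) = begin
      F K (q * a)         ≈⟨ F-shift-* Fa≈0 q 0 ⟩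
      c ^ q ℤ.* 0ℤ        ≡⟨ ℤ.*-zeroʳ (c ^ q) ⟩
      0ℤ                  ∎
      where open ≈-Reasoning

  period⇒rank∣ : ∀ {q} → IsPeriod K m q → a ∣ q
  period⇒rank∣ (_ , period) = Equivalence.to F≈0⇔rank∣ (mk≈ (Signed.∣ᵤ⇒∣ (period 0)))

  period-multiple⇔ : ∀ {j} → 0 < j → IsPeriod K m (j * a) ⇔ c ^ j ≈ 1ℤ
  period-multiple⇔ {j} 0<j = mk⇔ to from
    where
    open ≈-Reasoning
    to : IsPeriod K m (j * a) → c ^ j ≈ 1ℤ
    to (_ , period) = begin
      c ^ j                ≡⟨ ℤ.*-identityʳ (c ^ j) ⟨
      c ^ j ℤ.* F K 1      ≈⟨ F-shift-* Fa≈0 j 1 ⟨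
      F K (1 + j * a)      ≈⟨ mk≈ (Signed.∣ᵤ⇒∣ (period 1)) ⟩
      F K 1                ∎
    from : c ^ j ≈ 1ℤ → IsPeriod K m (j * a)
    from cʲ≈1 = *-monoˡ-< a 0<j , λ n → Signed.∣⇒∣ᵤ (_≈_.m∣x-y (begin
      F K (n + j * a)      ≈⟨ F-shift-* Fa≈0 j n ⟩
      c ^ j ℤ.* F K n      ≈⟨ *-cong cʲ≈1 (≈-refl {F K n}) ⟩
      1ℤ ℤ.* F K n         ≡⟨ ℤ.*-identityˡ (F K n) ⟩
      F K n                ∎))

  pisano-multiple⇒order : ∀ {j} → IsPisano K m (j * a) → IsOrder c j
  pisano-multiple⇒order {zero} ((() , _) , _)
  pisano-multiple⇒order {j@(suc _)} (period , shortest) =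
    z<s , Equivalence.to (period-multiple⇔ {j} z<s) period , least
    where
    least : ∀ {k} → 0 < k → c ^ k ≈ 1ℤ → j ≤ k
    least {k} 0<k cᵏ≈1 = ≮⇒≥ λ k<j → shortest (k * a) (*-monoˡ-< a 0<k) (*-monoˡ-< a k<j)
                                               (Equivalence.from (period-multiple⇔ {k} 0<k) cᵏ≈1)

  pisano⇒order : ∀ {p} → IsPisano K m p → ∃[ j ] p ≡ j * a × IsOrder c j
  pisano⇒order pisano@(period , _) =
    let divides j p≡ja = period⇒rank∣ period
    in j , p≡ja , pisano-multiple⇒order (subst (IsPisano K m) p≡ja pisano)

  ∣F⇔rank∣ : ∀ {n} → m ∣ ℤ.∣ F K n ∣ ⇔ a ∣ n
  ∣F⇔rank∣ = mk⇔ (Equivalence.to F≈0⇔rank∣ ∘ ∣⇒≈0) (≈0⇒∣ ∘ Equivalence.from F≈0⇔rank∣)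

  omega≡ : ∀ {p j} → p ≡ j * a → omegaUpTo K m p ≡ j
  omega≡ {j = j} refl = count-multiples (λ n → m ∣? ℤ.∣ F K n ∣) 0<a ∣F⇔rank∣ j

even-K⇒rank[2]≡2 : ∀ K → + 2 ∣ℤ K → IsRankOfApparition K 2 2
even-K⇒rank[2]≡2 K 2∣K = z<s , subst (+ 2 ∣ℤ_) (sym F2≡K) 2∣K , F≢0-below-2
  where
  F2≡K : F K 2 ≡ K
  F2≡K = trans (ℤ.+-identityʳ (K ℤ.* 1ℤ)) (ℤ.*-identityʳ K)
  F≢0-below-2 : ∀ n → 0 < n → n < 2 → ¬ + 2 ∣ℤ F K n
  F≢0-below-2 1 _ _ 2∣1 with () ← ∣1⇒≡1 2∣1
  F≢0-below-2 (suc (suc _)) _ (s<s (s<s ()))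

F-even⇔even : ∀ K → + 2 ∣ℤ K → ∀ {n} → 2 ∣ ℤ.∣ F K n ∣ ⇔ 2 ∣ n
F-even⇔even K 2∣K = Rank.∣F⇔rank∣ K 2 2 (even-K⇒rank[2]≡2 K 2∣K)

module EvenK (K : ℤ) (2∣K : + 2 ∣ℤ K) (m : ℕ) (1<m : 1 < m) (4∤m : ¬ 4 ∣ m)
             (a : ℕ) (rank : IsRankOfApparition K m a) where

  open Modulo m
  open FibonacciModulo K m
  open Rank K m a rank

  c≈1⇒¬4∣rank : c ≈ 1ℤ → ¬ 4 ∣ a
  c≈1⇒¬4∣rank c≈1 (divides zero a≡0) = <⇒≢ 0<a (sym a≡0)
  c≈1⇒¬4∣rank c≈1 (divides b@(suc _) a≡4b) = F≉0-below-rank z<s h<a (∣⇒≈0 m∣Fh)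
    where
    h = b * 2
    2∣h : 2 ∣ h
    2∣h = divides b refl
    h<a : h < a
    h<a = subst (h <_) (sym a≡4b) (*-monoʳ-< b (s<s (s<s z<s)))
    Fh≈-Fh : F K h ≈ -1ℤ ℤ.* F K h
    Fh≈-Fh = ≈-trans (F-reflect Fa≈0 c≈1 h h (trans (sym (*-distribˡ-+ b 2 2)) (sym a≡4b)))
                     (≈-reflexive (cong (λ s → -1ℤ ℤ.* s ℤ.* F K h) (-1^even 2∣h)))
    2Fh≈0 : + 2 ℤ.* F K h ≈ 0ℤ
    2Fh≈0 = begin
      + 2 ℤ.* F K h               ≡⟨ identity (F K h) ⟩
      F K h - -1ℤ ℤ.* F K h       ≈⟨ +-cong Fh≈-Fh (≈-refl { - (-1ℤ ℤ.* F K h)}) ⟩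
      -1ℤ ℤ.* F K h - -1ℤ ℤ.* F K h ≡⟨ ℤ.+-inverseʳ (-1ℤ ℤ.* F K h) ⟩
      0ℤ                          ∎
      where
      open ≈-Reasoning
      identity : ∀ x → + 2 ℤ.* x ≡ x - -1ℤ ℤ.* x
      identity = solve-∀
    m∣Fh : m ∣ ℤ.∣ F K h ∣
    m∣Fh = ∣2*x⇒∣x 4∤m (subst (m ∣_) (ℤ.abs-* (+ 2) (F K h)) (≈0⇒∣ 2Fh≈0))
                          (Equivalence.from (F-even⇔even K 2∣K) 2∣h)

  order-even-rank : ∀ {j} → 2 ∣ a → IsOrder c j → j ≡ 1 ⊎ j ≡ 2
  order-even-rank 2∣a order = irreducible[2] (Equivalence.to (order-∣⇔ order) c²≈1)
    where
    c²≈1 : c ^ 2 ≈ 1ℤ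
    c²≈1 = ≈-trans c²≈±1 (≈-reflexive (-1^even 2∣a))

  order-odd-rank : ∀ {j} → ¬ 2 ∣ a → IsOrder c j → j ≡ 4
  order-odd-rank {j} 2∤a order = ∣4∧∤2⇒≡4 (Equivalence.to (order-∣⇔ order) c⁴≈1) j∤2
    where
    open ≈-Reasoning
    c²≈-1 : c ^ 2 ≈ -1ℤ
    c²≈-1 = ≈-trans c²≈±1 (≈-reflexive (-1^odd 2∤a))
    c⁴≈1 : c ^ 4 ≈ 1ℤ
    c⁴≈1 = begin
      c ^ 4               ≡⟨ ℤ.^-distribˡ-+-* c 2 2 ⟩
      c ^ 2 ℤ.* c ^ 2     ≈⟨ *-cong c²≈-1 c²≈-1 ⟩
      1ℤ                  ∎
    m≢2 : m ≢ 2
    m≢2 m≡2 = 2∤a (Equivalence.to (F-even⇔even K 2∣K) (subst (_∣ ℤ.∣ F K a ∣) m≡2 (≈0⇒∣ Fa≈0)))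
    j∤2 : ¬ j ∣ 2
    j∤2 j∣2 = m≢2 (≤-antisym (∣⇒≤ (Signed.∣⇒∣ᵤ (_≈_.m∣x-y 1≈-1))) 1<m)
      where
      1≈-1 : 1ℤ ≈ -1ℤ
      1≈-1 = ≈-trans (≈-sym (Equivalence.from (order-∣⇔ order) j∣2)) c²≈-1

  pisano-odd-rank : ∀ {p} → ¬ 2 ∣ a → IsPisano K m p → p ≡ 4 * a
  pisano-odd-rank 2∤a pisano =
    let j , p≡ja , order = pisano⇒order pisano
    in trans p≡ja (cong (_* a) (order-odd-rank 2∤a order))

  pisano-even-rank : ∀ {p} → 2 ∣ a → IsPisano K m p → p ≡ 2 * a ⊎ (p ≡ 1 * a × ¬ 4 ∣ a)
  pisano-even-rank 2∣a pisano =
    let j , p≡ja , order = pisano⇒order pisano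
    in by-order p≡ja order (order-even-rank 2∣a order)
    where
    by-order : ∀ {p j} → p ≡ j * a → IsOrder c j → j ≡ 1 ⊎ j ≡ 2 → p ≡ 2 * a ⊎ (p ≡ 1 * a × ¬ 4 ∣ a)
    by-order p≡2a _ (inj₂ refl) = inj₁ p≡2a
    by-order p≡a (_ , c¹≈1 , _) (inj₁ refl) =
      inj₂ (p≡a , c≈1⇒¬4∣rank (≈-trans (≈-reflexive (sym (ℤ.*-identityʳ c))) c¹≈1))

  omega-cases : ∀ {p} → IsPisano K m p →
      (¬ 2 ∣ a × 4 ∣ p × omegaUpTo K m p ≡ 4)
    ⊎ (2 ∣ a × 4 ∣ p × omegaUpTo K m p ≡ 2)
    ⊎ (2 ∣ a × ¬ 4 ∣ p × omegaUpTo K m p ≡ 1)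
  omega-cases pisano with 2 ∣? a
  ... | no 2∤a = let p≡4a = pisano-odd-rank 2∤a pisano in
    inj₁ (2∤a , subst (4 ∣_) (sym p≡4a) (m∣m*n a) , omega≡ p≡4a)
  ... | yes 2∣a = inj₂ (Sum.map
    (λ p≡2a → 2∣a , subst (4 ∣_) (sym p≡2a) (*-monoʳ-∣ 2 2∣a) , omega≡ p≡2a)
    (λ (p≡a , 4∤a) → 2∣a , 4∤a ∘ subst (4 ∣_) (trans p≡a (*-identityˡ a)) , omega≡ p≡a)
    (pisano-even-rank 2∣a pisano))

-- Part (1) does not use 3 < m: an odd rank of apparition already excludes m = 2.
theorem4p29 : (K : ℤ) → (+ 2) ∣ℤ K → (m : ℕ) → 1 < m → ¬ (4 ∣ m) →
    (p a : ℕ) → IsPisano K m p → IsRankOfApparition K m a →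
    (3 < m → (omegaUpTo K m p ≡ 4 ⇔ (a % 4 ≡ 1 ⊎ a % 4 ≡ 3)))
    × (omegaUpTo K m p ≡ 2 ⇔ (4 ∣ p × 2 ∣ a))
    × (omegaUpTo K m p ≡ 1 ⇔ (¬ (4 ∣ p)))
theorem4p29 K 2∣K m 1<m 4∤m p a pisano rank with EvenK.omega-cases K 2∣K m 1<m 4∤m a rank pisano
... | inj₁ (2∤a , 4∣p , ω≡4) rewrite ω≡4 =
  (λ _ → mk⇔ (λ _ → Equivalence.to (¬2∣n⇔n%4≡1∨3 a) 2∤a) (λ _ → refl)) ,
  mk⇔ (λ ()) (λ (_ , 2∣a) → contradiction 2∣a 2∤a) ,
  mk⇔ (λ ()) (contradiction 4∣p)
... | inj₂ (inj₁ (2∣a , 4∣p , ω≡2)) rewrite ω≡2 =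
  (λ _ → mk⇔ (λ ()) (contradiction 2∣a ∘ Equivalence.from (¬2∣n⇔n%4≡1∨3 a))) ,
  mk⇔ (λ _ → 4∣p , 2∣a) (λ _ → refl) ,
  mk⇔ (λ ()) (contradiction 4∣p)
... | inj₂ (inj₂ (2∣a , 4∤p , ω≡1)) rewrite ω≡1 =
  (λ _ → mk⇔ (λ ()) (contradiction 2∣a ∘ Equivalence.from (¬2∣n⇔n%4≡1∨3 a))) ,
  mk⇔ (λ ()) (λ (4∣p , _) → contradiction 4∣p 4∤p) ,
  mk⇔ (λ _ → 4∤p) (λ _ → refl)
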